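{- Let $(G,s,t,A,B,\ell)$ be a reduced instance. If one of the canonical paths contains more than $4(\ell+1)^2+4$ vertices, then there is no token jumping reconfiguration sequence from $A$ to $B$ of length at most $\ell$.
   Context: Graphs are finite, simple, undirected; $s,t$ non-adjacent. An $s$-$t$-separator is a set $S\subseteq V(G)\setminus\{s,t\}$ such that $s,t$ are in different components of $G-S$; minimum means of minimum size $k$. A token jumping reconfiguration sequence from $A$ to $B$ is a sequence $A=S_1,\dots,S_r=B$ of minimum $s$-$t$-separators with $S_i=(S_{i-1}\setminus\{v\})\cup\{u\}$, $v\in S_{i-1}$, $u\in V(G)\setminus S_{i-1}$; its length is $r-1$. Canonical paths: a fixed set of $k$ pairwise internally vertex-disjoint chordless $s$-$t$-paths (every edge between two vertices of such a path belongs to the path). An instance $(G,s,t,A,B,\ell)$, where $A,B$ are minimum $s$-$t$-separators and $\ell$ an integer, is reduced if: every vertex of $G$ lies on a canonical path; every vertex of $A\cup B$ is adjacent to $s$ or $t$; every vertex of $G$ has degree at least $3$ and at most $2k$ and at most two neighbors on each canonical path; and $A\cap B=\emptyset$. -}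

module Defs where

open import Data.Nat as ℕ using (ℕ; zero; suc; _≤_)
open import Data.Fin using (Fin; toℕ; _≟_)
open import Data.Fin.Subset using (Subset; _∈_; _∉_; _∩_; _∪_; ⁅_⁆; _-_; ∣_∣)
open import Data.Vec using (tabulate)
open import Data.List using (List; []; _∷_; _++_; length; lookup)
open import Data.List.Relation.Unary.Linked using (Linked)
open import Data.List.Relation.Unary.Unique.Propositional using (Unique)
import Data.List.Membership.Propositional as LMem
import Data.List.Membership.DecPropositional as DecMem
open import Data.Product using (Σ; _×_; _,_; ∃)
open import Data.Sum using (_⊎_)
open import Data.Empty using (⊥)
open import Relation.Nullary using (¬_; Dec; does)
open import Relation.Binary.PropositionalEquality using (_≡_; _≢_)
open import Level using (0ℓ) renaming (suc to lsuc)

record Graph (n : ℕ) : Set₁ where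
  field
    Adj     : Fin n → Fin n → Set
    adj?    : ∀ u v → Dec (Adj u v)
    sym     : ∀ {u v} → Adj u v → Adj v u
    irrefl  : ∀ {u} → ¬ Adj u u
open Graph public

module _ {n : ℕ} (G : Graph n) where

  private module DMem = DecMem (_≟_ {n = n})

  N : Fin n → Subset n
  N v = tabulate (λ w → does (adj? G v w))

  degree : Fin n → ℕ
  degree v = ∣ N v ∣

  data Reach (S : Subset n) (u : Fin n) : Fin n → Set where
    here : u ∉ S → Reach S u u
    step : ∀ {v w} → Reach S u v → Adj G v w → w ∉ S → Reach S u w

  IsSep : Fin n → Fin n → Subset n → Set
  IsSep s t S = s ∉ S × t ∉ S × ¬ Reach S s t

  IsMinSep : Fin n → Fin n → Subset n → Set
  IsMinSep s t S = IsSep s t S × (∀ S′ → IsSep s t S′ → ∣ S ∣ ≤ ∣ S′ ∣)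

  Jump : Subset n → Subset n → Set
  Jump S S′ = Σ (Fin n) λ v → Σ (Fin n) λ u → v ∈ S × u ∉ S × S′ ≡ (S - v) ∪ ⁅ u ⁆

  -- TJSeq s t A B m : a token jumping reconfiguration sequence A = S_1,…,S_r = B
  -- of minimum s-t-separators, of length m = r - 1
  data TJSeq (s t : Fin n) : Subset n → Subset n → ℕ → Set where
    done : ∀ {A} → IsMinSep s t A → TJSeq s t A A 0
    step : ∀ {A A′ B m} → IsMinSep s t A → Jump A A′ → TJSeq s t A′ B m →
           TJSeq s t A B (suc m)

  -- An s-t path given by its inner vertices; its vertex list is s ∷ inner ++ t ∷ [].
  pathVertices : Fin n → Fin n → List (Fin n) → List (Fin n)
  pathVertices s t inner = s ∷ inner ++ t ∷ []

  IsChordlessPath : Fin n → Fin n → List (Fin n) → Set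
  IsChordlessPath s t inner =
    let p = pathVertices s t inner in
    Unique p × Linked (Adj G) p ×
    (∀ i j → Adj G (lookup p i) (lookup p j) →
       toℕ j ≡ suc (toℕ i) ⊎ toℕ i ≡ suc (toℕ j))

  vertexSet : List (Fin n) → Subset n
  vertexSet p = tabulate (λ w → does (w DMem.∈? p))

  -- k canonical paths: pairwise internally vertex-disjoint chordless s-t-paths
  -- (P i is the list of inner vertices of the i-th path)
  IsCanonical : (s t : Fin n) (k : ℕ) → (Fin k → List (Fin n)) → Set
  IsCanonical s t k P =
    (∀ i → IsChordlessPath s t (P i)) ×
    (∀ i j → i ≢ j → ∀ v → v LMem.∈ P i → ¬ (v LMem.∈ P j))

  IsReduced : (s t : Fin n) (A B : Subset n) (k : ℕ) → (Fin k → List (Fin n)) → Set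
  IsReduced s t A B k P =
    (∀ v → ∃ λ i → v LMem.∈ pathVertices s t (P i)) ×
    (∀ v → v ∈ A ⊎ v ∈ B → Adj G v s ⊎ Adj G v t) ×
    (∀ v → 3 ≤ degree v × degree v ≤ 2 ℕ.* k ×
           (∀ i → ∣ N v ∩ vertexSet (pathVertices s t (P i)) ∣ ≤ 2)) ×
    (∀ v → v ∈ A → v ∉ B)

{-# OPTIONS --safe #-}
module Submission where

-- Since A is a minimum separator of size k and the k canonical paths are
-- disjoint, every minimum separator has exactly one vertex ("token") in the
-- interior of each canonical path. Fix a canonical path Q. If one jump
-- moves the token of Q from position a to position b > a, every vertex of Q
-- strictly between a and b has a neighbour off Q (degree ≥ 3, at most two
-- neighbours on Q), and a path-walking argument shows that neighbour is one of
-- the k − 1 other tokens. Each of them has at most two neighbours on Q, so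
-- b − a ≤ 2k. The tokens of A and B on Q sit next to s or t, hence at opposite
-- ends of Q, so a sequence of length m moves the token by at least |Q| − 3,
-- while |Q| − 3 ≤ 2km ≤ 2m², because every token of A must move (A ∩ B = ∅).
-- For m ≤ ℓ this is far below 4(ℓ + 1)² + 4.

open import Defs hiding (sym)
open import Data.Nat using (ℕ)
open import Data.Fin using (Fin)
open import Data.Fin.Subset using (Subset; ∣_∣)
open import Data.List using (List; length)
open import Data.Product using (_×_; ∃; _,_)
open import Relation.Nullary using (¬_)
open import Relation.Binary.PropositionalEquality using (_≡_; _≢_)

-- The ℕ arithmetic is opened only inside this block, so that the operators in the
-- statement of lemma15 below refer to ℤ.
module _ where

  open import Data.Nat using (zero; suc; _+_; _*_; _∸_; _^_; _≤_; _<_; z≤n; s≤s) renaming (∣_-_∣ to ∣_−_∣)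
  open import Data.Nat.Properties
  open import Data.Fin using (toℕ; fromℕ<) renaming (zero to fzero; suc to fsuc; _≟_ to _≟ᶠ_)
  open import Data.Fin.Properties using (toℕ-fromℕ<; toℕ-injective; toℕ<n; any?) renaming (suc-injective to fsuc-injective)
  open import Data.Fin.Subset using (_∈_; _∉_; _⊆_; _⊂_; _∩_; _∪_; ⁅_⁆; _-_) renaming (⊥ to ∅)
  open import Data.Fin.Subset.Properties using (_∈?_; ∉⊥; ∣⊥∣≡0; ∣⁅x⁆∣≡1; x∈⁅x⁆; x∈⁅y⁆⇒x≡y; x∈p∪q⁺; x∈p∪q⁻; p⊆p∪q; x∈p∩q⁺; x∈p∧x≢y⇒x∈p-y; p─q⊆p; p⊆q⇒∣p∣≤∣q∣; p⊂q⇒∣p∣<∣q∣; x∈p⇒∣p-x∣<∣p∣)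
  open import Data.Bool using (true; false)
  open import Data.Vec using ([]; _∷_; here; there; tabulate)
  open import Data.Vec.Properties using (lookup∘tabulate; []=⇒lookup; lookup⇒[]=)
  open import Data.List using ([]; _∷_; _++_; lookup)
  open import Data.List.Properties using (length-++)
  open import Data.List.Membership.Propositional using () renaming (_∈_ to _∈ₗ_; _∉_ to _∉ₗ_)
  open import Data.List.Membership.Propositional.Properties using (∈-++⁺ˡ)
  open import Data.List.Relation.Unary.Any using () renaming (here to hereₗ; there to thereₗ)
  import Data.List.Relation.Unary.All as All
  open import Data.List.Relation.Unary.AllPairs using (_∷_)
  open import Data.List.Relation.Unary.Linked using (Linked; [-]; _∷_)
  open import Data.List.Relation.Unary.Unique.Propositional using (Unique)
  open import Data.Product using (_,_; proj₁; proj₂)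
  open import Data.Sum using (_⊎_; inj₁; inj₂)
  open import Data.Empty using (⊥; ⊥-elim)
  open import Relation.Nullary using (Dec; yes; no; does; _×-dec_; ¬?)
  open import Relation.Nullary.Decidable using (dec-true)
  open import Relation.Binary.PropositionalEquality using (refl; sym; trans; cong; subst; subst₂)
  open import Relation.Binary.Definitions using (tri<; tri≈; tri>)
  open import Function using (_∘_)
  open import Function.Definitions using (Injective)
  import Data.Integer as ℤ
  open import Data.Integer.Properties using (pos-+; pos-*; drop‿+<+)
  open import Data.Nat.Solver using (module +-*-Solver)

  module _ {A : Set} (d : A) where

    nth : List A → ℕ → A
    nth []       _       = d
    nth (x ∷ xs) zero    = x
    nth (x ∷ xs) (suc j) = nth xs j

    nth-∈ : ∀ xs {j} → j < length xs → nth xs j ∈ₗ xs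
    nth-∈ (x ∷ xs) {zero}  _       = hereₗ refl
    nth-∈ (x ∷ xs) {suc j} (s≤s j<) = thereₗ (nth-∈ xs j<)

    ∈⇒nth : ∀ {xs y} → y ∈ₗ xs → ∃ λ j → j < length xs × nth xs j ≡ y
    ∈⇒nth (hereₗ refl) = zero , s≤s z≤n , refl
    ∈⇒nth (thereₗ y∈) with ∈⇒nth y∈
    ... | j , j< , eq = suc j , s≤s j< , eq

    nth-++ˡ : ∀ xs ys {j} → j < length xs → nth (xs ++ ys) j ≡ nth xs j
    nth-++ˡ (x ∷ xs) ys {zero}  _        = refl
    nth-++ˡ (x ∷ xs) ys {suc j} (s≤s j<) = nth-++ˡ xs ys j<

    nth-++ʳ : ∀ xs ys j → nth (xs ++ ys) (length xs + j) ≡ nth ys j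
    nth-++ʳ []       ys j = refl
    nth-++ʳ (x ∷ xs) ys j = nth-++ʳ xs ys j

    nth-lookup : ∀ xs (i : Fin (length xs)) → nth xs (toℕ i) ≡ lookup xs i
    nth-lookup (x ∷ xs) fzero    = refl
    nth-lookup (x ∷ xs) (fsuc i) = nth-lookup xs i

    nth-injective : ∀ {xs} → Unique xs → ∀ {i j} → i < length xs → j < length xs →
                    nth xs i ≡ nth xs j → i ≡ j
    nth-injective {x ∷ xs} (x∉ ∷ u) {zero}  {zero}  _        _        _  = refl
    nth-injective {x ∷ xs} (x∉ ∷ u) {zero}  {suc j} _        (s≤s j<) eq = ⊥-elim (All.lookup x∉ (nth-∈ xs j<) eq)
    nth-injective {x ∷ xs} (x∉ ∷ u) {suc i} {zero}  (s≤s i<) _        eq = ⊥-elim (All.lookup x∉ (nth-∈ xs i<) (sym eq))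
    nth-injective {x ∷ xs} (x∉ ∷ u) {suc i} {suc j} (s≤s i<) (s≤s j<) eq = cong suc (nth-injective u i< j< eq)

    nth-linked : ∀ {R : A → A → Set} {xs} → Linked R xs → ∀ {j} → suc j < length xs →
                 R (nth xs j) (nth xs (suc j))
    nth-linked (r ∷ l) {zero}  _        = r
    nth-linked (r ∷ l) {suc j} (s≤s j<) = nth-linked l j<
    nth-linked [-]     (s≤s ())

  ∣p∪q∣≤∣p∣+∣q∣ : ∀ {n} (p q : Subset n) → ∣ p ∪ q ∣ ≤ ∣ p ∣ + ∣ q ∣
  ∣p∪q∣≤∣p∣+∣q∣ []          []          = z≤n
  ∣p∪q∣≤∣p∣+∣q∣ (true ∷ p)  (true ∷ q)  = s≤s (≤-trans (∣p∪q∣≤∣p∣+∣q∣ p q) (+-monoʳ-≤ ∣ p ∣ (n≤1+n ∣ q ∣)))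
  ∣p∪q∣≤∣p∣+∣q∣ (true ∷ p)  (false ∷ q) = s≤s (∣p∪q∣≤∣p∣+∣q∣ p q)
  ∣p∪q∣≤∣p∣+∣q∣ (false ∷ p) (true ∷ q)  = ≤-trans (s≤s (∣p∪q∣≤∣p∣+∣q∣ p q)) (≤-reflexive (sym (+-suc ∣ p ∣ ∣ q ∣)))
  ∣p∪q∣≤∣p∣+∣q∣ (false ∷ p) (false ∷ q) = ∣p∪q∣≤∣p∣+∣q∣ p q

  image : ∀ {n} m → (Fin m → Fin n) → Subset n
  image zero    f = ∅
  image (suc m) f = image m (f ∘ fsuc) ∪ ⁅ f fzero ⁆

  ∈image⁻ : ∀ {n} m (f : Fin m → Fin n) {y} → y ∈ image m f → ∃ λ i → f i ≡ y
  ∈image⁻ zero    f y∈ = ⊥-elim (∉⊥ y∈)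
  ∈image⁻ (suc m) f y∈ with x∈p∪q⁻ (image m (f ∘ fsuc)) _ y∈
  ... | inj₁ y∈′ = let i , eq = ∈image⁻ m (f ∘ fsuc) y∈′ in fsuc i , eq
  ... | inj₂ y∈′ = fzero , sym (x∈⁅y⁆⇒x≡y _ y∈′)

  image⊆ : ∀ {n} m (f : Fin m → Fin n) {S} → (∀ i → f i ∈ S) → image m f ⊆ S
  image⊆ m f f∈ y∈ with ∈image⁻ m f y∈
  ... | i , refl = f∈ i

  ≤∣image∣ : ∀ {n} m (f : Fin m → Fin n) → Injective _≡_ _≡_ f → m ≤ ∣ image m f ∣
  ≤∣image∣ zero    f inj = z≤n
  ≤∣image∣ (suc m) f inj =
    ≤-<-trans (≤∣image∣ m (f ∘ fsuc) (fsuc-injective ∘ inj))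
              (p⊂q⇒∣p∣<∣q∣ (p⊆p∪q _ , f fzero , x∈p∪q⁺ (inj₂ (x∈⁅x⁆ _)) , f0∉))
    where
    f0∉ : f fzero ∉ image m (f ∘ fsuc)
    f0∉ f0∈ with ∈image⁻ m (f ∘ fsuc) f0∈
    ... | i , eq with inj eq
    ... | ()

  ⋃[_]_ : ∀ {m n} → Subset m → (Fin m → Subset n) → Subset n
  ⋃[ [] ]        F = ∅
  ⋃[ true  ∷ X ] F = F fzero ∪ ⋃[ X ] (F ∘ fsuc)
  ⋃[ false ∷ X ] F = ⋃[ X ] (F ∘ fsuc)

  ∈⋃⁺ : ∀ {m n} (X : Subset m) (F : Fin m → Subset n) {x y} → x ∈ X → y ∈ F x → y ∈ ⋃[ X ] F
  ∈⋃⁺ (true  ∷ X) F here       y∈ = x∈p∪q⁺ (inj₁ y∈)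
  ∈⋃⁺ (true  ∷ X) F (there x∈) y∈ = x∈p∪q⁺ {p = F fzero} (inj₂ (∈⋃⁺ X (F ∘ fsuc) x∈ y∈))
  ∈⋃⁺ (false ∷ X) F (there x∈) y∈ = ∈⋃⁺ X (F ∘ fsuc) x∈ y∈

  ∣⋃∣≤ : ∀ {m n} c (X : Subset m) (F : Fin m → Subset n) → (∀ x → x ∈ X → ∣ F x ∣ ≤ c) →
         ∣ ⋃[ X ] F ∣ ≤ c * ∣ X ∣
  ∣⋃∣≤ {n = n} c [] F bound = ≤-trans (≤-reflexive (∣⊥∣≡0 n)) z≤n
  ∣⋃∣≤ c (true ∷ X) F bound =
    ≤-trans (∣p∪q∣≤∣p∣+∣q∣ (F fzero) (⋃[ X ] (F ∘ fsuc)))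
            (subst (∣ F fzero ∣ + ∣ ⋃[ X ] (F ∘ fsuc) ∣ ≤_) (sym (*-suc c ∣ X ∣))
                   (+-mono-≤ (bound fzero here) (∣⋃∣≤ c X (F ∘ fsuc) (λ x x∈ → bound (fsuc x) (there x∈)))))
  ∣⋃∣≤ c (false ∷ X) F bound = ∣⋃∣≤ c X (F ∘ fsuc) (λ x x∈ → bound (fsuc x) (there x∈))

  module _ {n} {P : Fin n → Set} (P? : ∀ w → Dec (P w)) where

    ∈tabulate-does⁺ : ∀ {w} → P w → w ∈ tabulate (does ∘ P?)
    ∈tabulate-does⁺ {w} p = lookup⇒[]= w _ (trans (lookup∘tabulate _ w) (dec-true (P? w) p))

    ∈tabulate-does⁻ : ∀ {w} → w ∈ tabulate (does ∘ P?) → P w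
    ∈tabulate-does⁻ {w} w∈ with P? w | trans (sym (lookup∘tabulate (does ∘ P?) w)) ([]=⇒lookup w∈)
    ... | yes p | _ = p
    ... | no _  | ()

  module _ {n} (G : Graph n) where

    ∈N⁺ : ∀ {v w} → Adj G v w → w ∈ N G v
    ∈N⁺ = ∈tabulate-does⁺ (adj? G _)

    ∈N⁻ : ∀ {v w} → w ∈ N G v → Adj G v w
    ∈N⁻ = ∈tabulate-does⁻ (adj? G _)

    ∈vertexSet⁺ : ∀ {p w} → w ∈ₗ p → w ∈ vertexSet G p
    ∈vertexSet⁺ {p} = ∈tabulate-does⁺ (_∈ₗ? p)
      where open import Data.List.Membership.DecPropositional (_≟ᶠ_ {n = n}) using () renaming (_∈?_ to _∈ₗ?_)

    reach-trans : ∀ {S u v w} → Reach G S u v → Reach G S v w → Reach G S u w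
    reach-trans r (here _)      = r
    reach-trans r (step r′ a w∉) = step (reach-trans r r′) a w∉

    reach-source∉ : ∀ {S u v} → Reach G S u v → u ∉ S
    reach-source∉ (here u∉)    = u∉
    reach-source∉ (step r _ _) = reach-source∉ r

    sep-no-crossing-edge : ∀ {s t S x y} → IsSep G s t S →
                           Reach G S s x → Adj G x y → Reach G S y t → ⊥
    sep-no-crossing-edge (_ , _ , s↛t) s⇝x x~y y⇝t =
      s↛t (reach-trans (step s⇝x x~y (reach-source∉ y⇝t)) y⇝t)

    minSep-size : ∀ {s t S S′} → IsMinSep G s t S → IsMinSep G s t S′ → ∣ S ∣ ≡ ∣ S′ ∣
    minSep-size (sep , min) (sep′ , min′) = ≤-antisym (min _ sep′) (min′ _ sep)

    tj-moved : ∀ {s t S B m} → TJSeq G s t S B m →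
               ∃ λ R → ∣ R ∣ ≤ m × (∀ {x} → x ∈ S → x ∈ B ⊎ x ∈ R)
    tj-moved (done _) = ∅ , ≤-reflexive (∣⊥∣≡0 n) , inj₁
    tj-moved {S = S} {B} (step {m = m} _ (v , _ , _ , _ , refl) rest) with tj-moved rest
    ... | R , ∣R∣≤ , covered = R ∪ ⁅ v ⁆ , size , covered′
      where
      size : ∣ R ∪ ⁅ v ⁆ ∣ ≤ suc m
      size = begin
        ∣ R ∪ ⁅ v ⁆ ∣        ≤⟨ ∣p∪q∣≤∣p∣+∣q∣ R ⁅ v ⁆ ⟩
        ∣ R ∣ + ∣ ⁅ v ⁆ ∣    ≡⟨ cong (∣ R ∣ +_) (∣⁅x⁆∣≡1 v) ⟩
        ∣ R ∣ + 1            ≡⟨ +-comm ∣ R ∣ 1 ⟩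
        suc ∣ R ∣            ≤⟨ s≤s ∣R∣≤ ⟩
        suc m                ∎
        where open ≤-Reasoning
      covered′ : ∀ {x} → x ∈ S → x ∈ B ⊎ x ∈ R ∪ ⁅ v ⁆
      covered′ {x} x∈ with x ≟ᶠ v
      ... | yes refl = inj₂ (x∈p∪q⁺ (inj₂ (x∈⁅x⁆ v)))
      ... | no x≢v with covered (x∈p∪q⁺ (inj₁ (x∈p∧x≢y⇒x∈p-y x∈ x≢v)))
      ...   | inj₁ x∈B = inj₁ x∈B
      ...   | inj₂ x∈R = inj₂ (x∈p∪q⁺ (inj₁ x∈R))

    disjoint-tj-length : ∀ {s t S B m} → TJSeq G s t S B m → (∀ {x} → x ∈ S → x ∉ B) → ∣ S ∣ ≤ m
    disjoint-tj-length seq disjoint with tj-moved seq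
    ... | R , ∣R∣≤ , covered = ≤-trans (p⊆q⇒∣p∣≤∣q∣ S⊆R) ∣R∣≤
      where
      S⊆R : _ ⊆ R
      S⊆R x∈ with covered x∈
      ... | inj₁ x∈B = ⊥-elim (disjoint x∈ x∈B)
      ... | inj₂ x∈R = x∈R

  1+n≤∣1-n∣+2 : ∀ n → suc n ≤ ∣ 1 − n ∣ + 2
  1+n≤∣1-n∣+2 zero    = s≤s z≤n
  1+n≤∣1-n∣+2 (suc n) = ≤-reflexive (+-comm 2 n)

  module ChordlessPath {n} (G : Graph n) (s t : Fin n) (Q : List (Fin n))
                       (chordless : IsChordlessPath G s t Q) where

    vertices : List (Fin n)
    vertices = pathVertices G s t Q

    end : ℕ
    end = suc (length Q)

    -- vtx 0 = s, vtx end = t, and the interior of Q is at positions 1 … end − 1.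
    vtx : ℕ → Fin n
    vtx = nth s vertices

    Interior : ℕ → Set
    Interior j = 1 ≤ j × j < end

    length-vertices : length vertices ≡ suc end
    length-vertices = cong suc (trans (length-++ Q) (+-comm (length Q) 1))

    ≤end⇒<length : ∀ {j} → j ≤ end → j < length vertices
    ≤end⇒<length {j} j≤ = subst (j <_) (sym length-vertices) (s≤s j≤)

    vtx-end : vtx end ≡ t
    vtx-end = trans (cong (nth s (Q ++ t ∷ [])) (sym (+-identityʳ (length Q)))) (nth-++ʳ s Q (t ∷ []) 0)

    vtx-suc : ∀ {j} → j < length Q → vtx (suc j) ≡ nth s Q j
    vtx-suc j< = nth-++ˡ s Q (t ∷ []) j<

    ∈interior⇒vtx : ∀ {y} → y ∈ₗ Q → ∃ λ j → Interior j × vtx j ≡ y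
    ∈interior⇒vtx y∈ with ∈⇒nth s y∈
    ... | j , j< , eq = suc j , (s≤s z≤n , s≤s j<) , trans (vtx-suc j<) eq

    vtx-interior : ∀ {j} → Interior j → vtx j ∈ₗ Q
    vtx-interior {suc j} (_ , s≤s j<) = subst (_∈ₗ Q) (sym (vtx-suc j<)) (nth-∈ s Q j<)

    vtx-∈ : ∀ {j} → j ≤ end → vtx j ∈ₗ vertices
    vtx-∈ j≤ = nth-∈ s vertices (≤end⇒<length j≤)

    vtx-injective : ∀ {i j} → i ≤ end → j ≤ end → vtx i ≡ vtx j → i ≡ j
    vtx-injective i≤ j≤ = nth-injective s (proj₁ chordless) (≤end⇒<length i≤) (≤end⇒<length j≤)

    vtx-adjacent : ∀ {j} → j < end → Adj G (vtx j) (vtx (suc j))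
    vtx-adjacent j< = nth-linked s (proj₁ (proj₂ chordless)) (≤end⇒<length j<)

    vtx-chordless : ∀ {i j} → i ≤ end → j ≤ end → Adj G (vtx i) (vtx j) → j ≡ suc i ⊎ i ≡ suc j
    vtx-chordless {i} {j} i≤ j≤ i~j =
      subst₂ (λ x y → y ≡ suc x ⊎ x ≡ suc y) (toℕ-fromℕ< i<) (toℕ-fromℕ< j<)
        (proj₂ (proj₂ chordless) _ _ (subst₂ (Adj G) (lookup≡vtx i i<) (lookup≡vtx j j<) i~j))
      where
      i< = ≤end⇒<length i≤
      j< = ≤end⇒<length j≤
      lookup≡vtx : ∀ x (x< : x < length vertices) → vtx x ≡ lookup vertices (fromℕ< x<)
      lookup≡vtx x x< = trans (cong vtx (sym (toℕ-fromℕ< x<))) (nth-lookup s vertices (fromℕ< x<))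

    ∈vertices⇒terminal⊎interior : ∀ {w} → w ∈ₗ vertices → w ≡ s ⊎ w ≡ t ⊎ w ∈ₗ Q
    ∈vertices⇒terminal⊎interior w∈ with ∈⇒nth s w∈
    ... | zero  , _  , eq = inj₁ (sym eq)
    ... | suc j , j< , eq with m≤n⇒m<n∨m≡n (subst (suc j <_) length-vertices j<)
    ...   | inj₂ refl       = inj₂ (inj₁ (trans (sym eq) vtx-end))
    ...   | inj₁ (s≤s j<′) = inj₂ (inj₂ (subst (_∈ₗ Q) eq (vtx-interior (s≤s z≤n , j<′))))

    interior≢s : ∀ {w} → w ∈ₗ Q → w ≢ s
    interior≢s w∈ refl with ∈interior⇒vtx w∈
    ... | j , (1≤j , j<) , eq with vtx-injective (<⇒≤ j<) z≤n eq
    ...   | refl = <⇒≱ 1≤j z≤n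

    interior≢t : ∀ {w} → w ∈ₗ Q → w ≢ t
    interior≢t w∈ refl with ∈interior⇒vtx w∈
    ... | j , (_ , j<) , eq with vtx-injective (<⇒≤ j<) ≤-refl (trans eq (sym vtx-end))
    ...   | refl = <⇒≱ j< ≤-refl

    reach-along : ∀ S {i} j → i ≤ j → j ≤ end → (∀ x → i ≤ x → x ≤ j → vtx x ∉ S) →
                  Reach G S (vtx i) (vtx j)
    reach-along S zero    z≤n _ avoid = here (avoid 0 z≤n z≤n)
    reach-along S (suc j) i≤ j< avoid with m≤n⇒m<n∨m≡n i≤
    ... | inj₂ refl     = here (avoid _ ≤-refl ≤-refl)
    ... | inj₁ (s≤s i≤j) =
      step (reach-along S j i≤j (<⇒≤ j<) (λ x i≤x x≤j → avoid x i≤x (m≤n⇒m≤1+n x≤j)))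
           (vtx-adjacent j<) (avoid (suc j) i≤ ≤-refl)

    terminal-neighbour-position : ∀ {c} → Interior c → Adj G (vtx c) s ⊎ Adj G (vtx c) t →
                                  c ≡ 1 ⊎ suc c ≡ end
    terminal-neighbour-position (_ , c<) (inj₁ c~s) with vtx-chordless (<⇒≤ c<) z≤n c~s
    ... | inj₁ ()
    ... | inj₂ c≡1 = inj₁ c≡1
    terminal-neighbour-position (_ , c<) (inj₂ c~t)
      with vtx-chordless (<⇒≤ c<) ≤-refl (subst (Adj G _) (sym vtx-end) c~t)
    ... | inj₁ end≡ = inj₂ (sym end≡)
    ... | inj₂ refl = ⊥-elim (<-irrefl refl (<-trans c< (n<1+n _)))

    terminal-neighbours-apart : ∀ {x y} → x ≢ y → x ≡ 1 ⊎ suc x ≡ end → y ≡ 1 ⊎ suc y ≡ end →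
                                end ≤ ∣ x − y ∣ + 2
    terminal-neighbours-apart x≢y (inj₁ refl) (inj₁ refl) = ⊥-elim (x≢y refl)
    terminal-neighbours-apart x≢y (inj₂ x+1) (inj₂ y+1) = ⊥-elim (x≢y (suc-injective (trans x+1 (sym y+1))))
    terminal-neighbours-apart _ (inj₁ refl) (inj₂ refl) = 1+n≤∣1-n∣+2 _
    terminal-neighbours-apart _ (inj₂ refl) (inj₁ refl) =
      subst (end ≤_) (cong (_+ 2) (∣-∣-comm 1 (length Q))) (1+n≤∣1-n∣+2 _)

  module Canonical {n} (G : Graph n) (s t : Fin n) (k : ℕ) (P : Fin k → List (Fin n))
                   (canonical : IsCanonical G s t k P) where

    module Path (r : Fin k) = ChordlessPath G s t (P r) (proj₁ canonical r)
    open Path public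

    interiors-disjoint : ∀ {r r′ z} → z ∈ₗ P r → z ∈ₗ P r′ → r ≡ r′
    interiors-disjoint {r} {r′} z∈ z∈′ with r ≟ᶠ r′
    ... | yes eq  = eq
    ... | no r≢r′ = ⊥-elim (proj₂ canonical r r′ r≢r′ _ z∈ z∈′)

    interior∉other-path : ∀ {r r′ w} → r ≢ r′ → w ∈ₗ P r → w ∉ₗ vertices r′
    interior∉other-path r≢r′ w∈ w∈′ with ∈vertices⇒terminal⊎interior _ w∈′
    ... | inj₁ w≡s        = interior≢s _ w∈ w≡s
    ... | inj₂ (inj₁ w≡t) = interior≢t _ w∈ w≡t
    ... | inj₂ (inj₂ w∈″) = r≢r′ (interiors-disjoint w∈ w∈″)

    sep-meets-interior : ∀ {S} → IsSep G s t S → ∀ r → ∃ λ j → Interior r j × vtx r j ∈ S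
    sep-meets-interior {S} (s∉ , t∉ , s↛t) r with anyUpTo? (λ j → vtx r j ∈? S) (suc (end r))
    ... | yes (zero , _ , s∈) = ⊥-elim (s∉ s∈)
    ... | yes (suc j , s≤s j≤ , x∈) with m≤n⇒m<n∨m≡n j≤
    ...   | inj₁ j<    = suc j , (s≤s z≤n , j<) , x∈
    ...   | inj₂ refl = ⊥-elim (t∉ (subst (_∈ S) (vtx-end r) x∈))
    sep-meets-interior {S} (s∉ , t∉ , s↛t) r | no none =
      ⊥-elim (s↛t (subst (Reach G S s) (vtx-end r)
                     (reach-along r S (end r) z≤n ≤-refl (λ x _ x≤ x∈ → none (x , s≤s x≤ , x∈)))))

    module Tight {S} (sep : IsSep G s t S) (size : ∣ S ∣ ≡ k) where

      token-unique : ∀ r {x y} → x ∈ₗ P r → x ∈ S → y ∈ₗ P r → y ∈ S → x ≡ y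
      token-unique r x∈P x∈S y∈P y∈S = trans (≡chosen x∈P x∈S) (sym (≡chosen y∈P y∈S))
        where
        chosen : Fin k → Fin n
        chosen r′ = vtx r′ (proj₁ (sep-meets-interior sep r′))

        chosen∈P : ∀ r′ → chosen r′ ∈ₗ P r′
        chosen∈P r′ = vtx-interior r′ (proj₁ (proj₂ (sep-meets-interior sep r′)))

        chosen-injective : Injective _≡_ _≡_ chosen
        chosen-injective {i} {j} eq = interiors-disjoint (chosen∈P i) (subst (_∈ₗ P j) (sym eq) (chosen∈P j))

        ≡chosen : ∀ {z} → z ∈ₗ P r → z ∈ S → z ≡ chosen r
        ≡chosen {z} z∈P z∈S with z ≟ᶠ chosen r
        ... | yes eq  = eq
        ... | no z≢ = ⊥-elim (<-irrefl refl (subst (k <_) size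
                        (≤-<-trans (≤∣image∣ k chosen chosen-injective) (p⊂q⇒∣p∣<∣q∣ image⊂S))))
          where
          z∉image : z ∉ image k chosen
          z∉image z∈ with ∈image⁻ k chosen z∈
          ... | r′ , eq with interiors-disjoint z∈P (subst (_∈ₗ P r′) eq (chosen∈P r′))
          ...   | refl = z≢ (sym eq)

          image⊂S : image k chosen ⊂ S
          image⊂S = image⊆ k chosen (λ r′ → proj₂ (proj₂ (sep-meets-interior sep r′))) , z , z∈S , z∉image

      position-unique : ∀ r {i j} → Interior r i → Interior r j → vtx r i ∈ S → vtx r j ∈ S → i ≡ j
      position-unique r i-int j-int i∈ j∈ =
        vtx-injective r (<⇒≤ (proj₂ i-int)) (<⇒≤ (proj₂ j-int))
          (token-unique r (vtx-interior r i-int) i∈ (vtx-interior r j-int) j∈)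

      only-token : ∀ r {d} → Interior r d → vtx r d ∈ S → ∀ j → j ≤ end r → j ≢ d → vtx r j ∉ S
      only-token r d-int d∈ zero    _  _   j∈ = proj₁ sep j∈
      only-token r d-int d∈ (suc j) j≤ j≢d j∈ with m≤n⇒m<n∨m≡n j≤
      ... | inj₁ j<    = j≢d (position-unique r (s≤s z≤n , j<) d-int j∈ d∈)
      ... | inj₂ refl = proj₁ (proj₂ sep) (subst (_∈ S) (vtx-end r) j∈)

      reach-before : ∀ r {c d} → Interior r d → vtx r d ∈ S → c < d → Reach G S s (vtx r c)
      reach-before r {c} d-int d∈ c<d =
        reach-along r S c z≤n c≤end
          (λ x _ x≤c → only-token r d-int d∈ x (≤-trans x≤c c≤end) (λ { refl → <⇒≱ c<d x≤c }))
        where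
        c≤end = <⇒≤ (<-trans c<d (proj₂ d-int))

      reach-after : ∀ r {c d} → Interior r d → vtx r d ∈ S → d < c → c ≤ end r → Reach G S (vtx r c) t
      reach-after r {c} d-int d∈ d<c c≤end =
        subst (Reach G S (vtx r c)) (vtx-end r)
          (reach-along r S (end r) c≤end ≤-refl
            (λ x c≤x x≤end → only-token r d-int d∈ x x≤end (λ { refl → <⇒≱ d<c c≤x })))

  module Reduced {n} (G : Graph n) (s t : Fin n) (k : ℕ) (P : Fin k → List (Fin n))
                 (canonical : IsCanonical G s t k P)
                 (covered : ∀ v → ∃ λ i → v ∈ₗ pathVertices G s t (P i))
                 (degree≥3 : ∀ v → 3 ≤ degree G v)
                 (few-on-path : ∀ v i → ∣ N G v ∩ vertexSet G (pathVertices G s t (P i)) ∣ ≤ 2) where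

    open Canonical G s t k P canonical

    neighbour-off-path : ∀ i v → ∃ λ w → Adj G v w × w ∉ₗ vertices i
    neighbour-off-path i v with any? (λ w → adj? G v w ×-dec ¬? (w ∈? vertexSet G (vertices i)))
    ... | yes (w , v~w , w∉) = w , v~w , w∉ ∘ ∈vertexSet⁺ G
    ... | no none = ⊥-elim (≤⇒≯ (≤-trans (p⊆q⇒∣p∣≤∣q∣ N⊆) (few-on-path v i)) (degree≥3 v))
      where
      N⊆ : N G v ⊆ N G v ∩ vertexSet G (vertices i)
      N⊆ {w} w∈ with w ∈? vertexSet G (vertices i)
      ... | yes w∈′ = x∈p∩q⁺ (w∈ , w∈′)
      ... | no w∉   = ⊥-elim (none (w , ∈N⁻ G w∈ , w∉))

    off-path⇒other-interior : ∀ i {w} → w ∉ₗ vertices i → ∃ λ r → r ≢ i × w ∈ₗ P r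
    off-path⇒other-interior i {w} w∉ with covered w
    ... | r , w∈ with ∈vertices⇒terminal⊎interior r w∈
    ...   | inj₁ refl        = ⊥-elim (w∉ (vtx-∈ i z≤n))
    ...   | inj₂ (inj₁ refl) = ⊥-elim (w∉ (subst (_∈ₗ vertices i) (vtx-end i) (vtx-∈ i ≤-refl)))
    ...   | inj₂ (inj₂ w∈P)  = r , (λ { refl → w∉ (thereₗ (∈-++⁺ˡ w∈P)) }) , w∈P

    module ForwardJump (i : Fin k) {S S′} (sep : IsSep G s t S) (size : ∣ S ∣ ≡ k)
                       (sep′ : IsSep G s t S′) (size′ : ∣ S′ ∣ ≡ k)
                       (agree : ∀ w → w ∉ₗ vertices i → w ∈ S → w ∈ S′)
                       {a b} (a-int : Interior i a) (a∈ : vtx i a ∈ S)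
                       (b-int : Interior i b) (b∈ : vtx i b ∈ S′) where

      module T  = Tight sep size
      module T′ = Tight sep′ size′

      -- The neighbour w lies on another path r, at position c, and S meets r at d.
      -- If c < d, then s ⇝ w – vtx j ⇝ t avoids S; if c > d, then s ⇝ vtx j – w ⇝ t avoids S′.
      between-neighbour∈ : ∀ {j w} → a < j → j < b → Adj G (vtx i j) w → w ∉ₗ vertices i → w ∈ S
      between-neighbour∈ {j} a<j j<b j~w w∉ with off-path⇒other-interior i w∉
      ... | r , r≢i , w∈P with ∈interior⇒vtx r w∈P | sep-meets-interior sep r
      ...   | c , (_ , c<) , refl | d , d-int , d∈ with <-cmp c d
      ...     | tri≈ _ refl _ = d∈
      ...     | tri< c<d _ _  =
        ⊥-elim (sep-no-crossing-edge G sep (T.reach-before r d-int d∈ c<d) (Graph.sym G j~w)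
                                           (T.reach-after i a-int a∈ a<j j≤end))
        where j≤end = <⇒≤ (<-trans j<b (proj₂ b-int))
      ...     | tri> _ _ d<c  =
        ⊥-elim (sep-no-crossing-edge G sep′ (T′.reach-before i b-int b∈ j<b) j~w
                                            (T′.reach-after r d-int d∈′ d<c (<⇒≤ c<)))
        where d∈′ = agree _ (interior∉other-path r≢i (vtx-interior r d-int)) d∈

      Others : Subset n
      Others = S - vtx i a

      NbrsOnPath : Fin n → Subset n
      NbrsOnPath x = N G x ∩ vertexSet G (vertices i)

      between∈⋃ : ∀ {j} → a < j → j < b → vtx i j ∈ ⋃[ Others ] NbrsOnPath
      between∈⋃ {j} a<j j<b with neighbour-off-path i (vtx i j)
      ... | w , j~w , w∉ = ∈⋃⁺ Others NbrsOnPath w∈Others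
                             (x∈p∩q⁺ (∈N⁺ G (Graph.sym G j~w) , ∈vertexSet⁺ G (vtx-∈ i (<⇒≤ (<-trans j<b (proj₂ b-int))))))
        where
        w∈Others : w ∈ Others
        w∈Others = x∈p∧x≢y⇒x∈p-y (between-neighbour∈ a<j j<b j~w w∉)
                                  (λ { refl → w∉ (vtx-∈ i (<⇒≤ (proj₂ a-int))) })

      jump-forward : a < b → ∣ a − b ∣ ≤ 2 * k
      jump-forward a<b = subst (_≤ 2 * k) (sym (m≤n⇒∣m-n∣≡n∸m (<⇒≤ a<b))) (m≤n+o⇒m∸n≤o b a b≤)
        where
        gap = b ∸ suc a

        between : Fin gap → Fin n
        between x = vtx i (suc a + toℕ x)

        between< : ∀ x → suc a + toℕ x < b
        between< x = subst (suc a + toℕ x <_) (m+[n∸m]≡n a<b) (+-monoʳ-< (suc a) (toℕ<n x))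

        between-injective : Injective _≡_ _≡_ between
        between-injective {x} {y} eq = toℕ-injective (+-cancelˡ-≡ (suc a) _ _
          (vtx-injective i (<⇒≤ (<-trans (between< x) (proj₂ b-int))) (<⇒≤ (<-trans (between< y) (proj₂ b-int))) eq))

        gap≤ : gap ≤ 2 * ∣ Others ∣
        gap≤ = begin
          gap                          ≤⟨ ≤∣image∣ gap between between-injective ⟩
          ∣ image gap between ∣        ≤⟨ p⊆q⇒∣p∣≤∣q∣ (image⊆ gap between (λ x → between∈⋃ (m≤m+n (suc a) (toℕ x)) (between< x))) ⟩
          ∣ ⋃[ Others ] NbrsOnPath ∣   ≤⟨ ∣⋃∣≤ 2 Others NbrsOnPath (λ x _ → few-on-path x i) ⟩
          2 * ∣ Others ∣               ∎
          where open ≤-Reasoning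

        b≤ : b ≤ a + 2 * k
        b≤ = begin
          b                          ≡⟨ sym (m+[n∸m]≡n a<b) ⟩
          suc a + gap                ≡⟨ sym (+-suc a gap) ⟩
          a + suc gap                ≤⟨ +-monoʳ-≤ a (s≤s gap≤) ⟩
          a + suc (2 * ∣ Others ∣)   ≤⟨ +-monoʳ-≤ a (n≤1+n _) ⟩
          a + (2 + 2 * ∣ Others ∣)   ≡⟨ cong (a +_) (sym (*-suc 2 ∣ Others ∣)) ⟩
          a + 2 * suc ∣ Others ∣     ≤⟨ +-monoʳ-≤ a (*-monoʳ-≤ 2 (subst (suc ∣ Others ∣ ≤_) size (x∈p⇒∣p-x∣<∣p∣ a∈))) ⟩
          a + 2 * k                  ∎
          where open ≤-Reasoning

    module Sequences (A : Subset n) (A-min : IsMinSep G s t A) (A-size : ∣ A ∣ ≡ k) (i : Fin k) where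

      tight : ∀ {S} → IsMinSep G s t S → ∣ S ∣ ≡ k
      tight S-min = trans (minSep-size G S-min A-min) A-size

      position-unique : ∀ {S} → IsMinSep G s t S → ∀ {a b} → Interior i a → Interior i b →
                        vtx i a ∈ S → vtx i b ∈ S → a ≡ b
      position-unique S-min = Tight.position-unique (proj₁ S-min) (tight S-min) i

      jump-agrees-off-path : ∀ {S S′} → IsMinSep G s t S → IsMinSep G s t S′ → Jump G S S′ →
                             ∀ {a a′} → Interior i a → vtx i a ∈ S → Interior i a′ → vtx i a′ ∈ S′ → a ≢ a′ →
                             ∀ w → w ∉ₗ vertices i → (w ∈ S → w ∈ S′) × (w ∈ S′ → w ∈ S)
      jump-agrees-off-path {S} S-min S′-min (v , u , _ , _ , refl) {a} {a′} a-int a∈ a′-int a′∈ a≢a′ w w∉ =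
        leave , enter
        where
        moved : vtx i a ≡ v
        moved with vtx i a ≟ᶠ v
        ... | yes eq = eq
        ... | no a≢v = ⊥-elim (a≢a′ (position-unique S′-min a-int a′-int
                         (x∈p∪q⁺ (inj₁ (x∈p∧x≢y⇒x∈p-y a∈ a≢v))) a′∈))
        placed : vtx i a′ ≡ u
        placed with x∈p∪q⁻ (S - v) ⁅ u ⁆ a′∈
        ... | inj₁ a′∈S-v = ⊥-elim (a≢a′ (position-unique S-min a-int a′-int a∈ (p─q⊆p S ⁅ v ⁆ a′∈S-v)))
        ... | inj₂ a′∈u   = x∈⁅y⁆⇒x≡y u a′∈u
        leave : w ∈ S → w ∈ (S - v) ∪ ⁅ u ⁆
        leave w∈ = x∈p∪q⁺ (inj₁ (x∈p∧x≢y⇒x∈p-y w∈ λ { refl → w∉ (subst (_∈ₗ vertices i) moved (vtx-∈ i (<⇒≤ (proj₂ a-int)))) }))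
        enter : w ∈ (S - v) ∪ ⁅ u ⁆ → w ∈ S
        enter w∈ with x∈p∪q⁻ (S - v) ⁅ u ⁆ w∈
        ... | inj₁ w∈S-v = p─q⊆p S ⁅ v ⁆ w∈S-v
        ... | inj₂ w∈u   = ⊥-elim (w∉ (subst (_∈ₗ vertices i) (trans placed (sym (x∈⁅y⁆⇒x≡y u w∈u)))
                                                             (vtx-∈ i (<⇒≤ (proj₂ a′-int)))))

      jump-displacement : ∀ {S S′} → IsMinSep G s t S → IsMinSep G s t S′ → Jump G S S′ →
                          ∀ {a a′} → Interior i a → vtx i a ∈ S → Interior i a′ → vtx i a′ ∈ S′ →
                          ∣ a − a′ ∣ ≤ 2 * k
      jump-displacement S-min S′-min J {a} {a′} a-int a∈ a′-int a′∈ with <-cmp a a′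
      ... | tri≈ _ refl _ = ≤-trans (≤-reflexive (∣n-n∣≡0 a)) z≤n
      ... | tri< a<a′ a≢a′ _ =
        ForwardJump.jump-forward i (proj₁ S-min) (tight S-min) (proj₁ S′-min) (tight S′-min)
          (λ w w∉ → proj₁ (agree w w∉)) a-int a∈ a′-int a′∈ a<a′
        where agree = jump-agrees-off-path S-min S′-min J a-int a∈ a′-int a′∈ a≢a′
      ... | tri> _ a≢a′ a′<a =
        subst (_≤ 2 * k) (∣-∣-comm a′ a)
          (ForwardJump.jump-forward i (proj₁ S′-min) (tight S′-min) (proj₁ S-min) (tight S-min)
            (λ w w∉ → proj₂ (agree w w∉)) a′-int a′∈ a-int a∈ a′<a)
        where agree = jump-agrees-off-path S-min S′-min J a-int a∈ a′-int a′∈ a≢a′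

      tj-source-min : ∀ {S B m} → TJSeq G s t S B m → IsMinSep G s t S
      tj-source-min (done S-min)     = S-min
      tj-source-min (step S-min _ _) = S-min

      tj-displacement : ∀ {S B m} → TJSeq G s t S B m → ∀ {a b} → Interior i a → vtx i a ∈ S →
                        Interior i b → vtx i b ∈ B → ∣ a − b ∣ ≤ m * (2 * k)
      tj-displacement (done S-min) {a} a-int a∈ b-int b∈ with position-unique S-min a-int b-int a∈ b∈
      ... | refl = ≤-reflexive (∣n-n∣≡0 a)
      tj-displacement (step S-min J rest) {a} {b} a-int a∈ b-int b∈ with sep-meets-interior (proj₁ (tj-source-min rest)) i
      ... | a′ , a′-int , a′∈ =
        ≤-trans (∣-∣-triangle a a′ b)
                (+-mono-≤ (jump-displacement S-min (tj-source-min rest) J a-int a∈ a′-int a′∈)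
                          (tj-displacement rest a′-int a′∈ b-int b∈))

  reduced-path-length-bound :
    ∀ {n} (G : Graph n) (s t : Fin n) (A B : Subset n) (k : ℕ) (P : Fin k → List (Fin n)) →
    IsMinSep G s t A → IsMinSep G s t B → ∣ A ∣ ≡ k →
    IsCanonical G s t k P → IsReduced G s t A B k P →
    ∀ i m → TJSeq G s t A B m → length (pathVertices G s t (P i)) ≤ 3 + m * (2 * m)
  reduced-path-length-bound G s t A B k P A-min B-min A-size canonical
                            (covered , terminal , degrees , disjoint) i m seq =
    bound (sep-meets-interior (proj₁ A-min) i) (sep-meets-interior (proj₁ B-min) i)
    where
    open Canonical G s t k P canonical
    open Reduced G s t k P canonical covered (proj₁ ∘ degrees) (λ v → proj₂ (proj₂ (degrees v)))

    k≤m : k ≤ m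
    k≤m = subst (_≤ m) A-size (disjoint-tj-length G seq (λ {x} → disjoint x))

    position : ∀ {c} → Interior i c → vtx i c ∈ A ⊎ vtx i c ∈ B → c ≡ 1 ⊎ suc c ≡ end i
    position c-int c∈ = terminal-neighbour-position i c-int (terminal _ c∈)

    bound : (∃ λ a → Interior i a × vtx i a ∈ A) → (∃ λ b → Interior i b × vtx i b ∈ B) →
            length (vertices i) ≤ 3 + m * (2 * m)
    bound (a , a-int , a∈) (b , b-int , b∈) = begin
      length (vertices i)  ≡⟨ length-vertices i ⟩
      suc (end i)          ≤⟨ s≤s (terminal-neighbours-apart i a≢b (position a-int (inj₁ a∈))
                                                                   (position b-int (inj₂ b∈))) ⟩
      suc (∣ a − b ∣ + 2)  ≡⟨ +-comm (suc ∣ a − b ∣) 2 ⟩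
      3 + ∣ a − b ∣        ≤⟨ +-monoʳ-≤ 3 (Sequences.tj-displacement A A-min A-size i seq a-int a∈ b-int b∈) ⟩
      3 + m * (2 * k)      ≤⟨ +-monoʳ-≤ 3 (*-monoʳ-≤ m (*-monoʳ-≤ 2 k≤m)) ⟩
      3 + m * (2 * m)      ∎
      where
      open ≤-Reasoning
      a≢b : a ≢ b
      a≢b refl = disjoint _ a∈ b∈

  pos-^ : ∀ m e → ℤ.+ (m ^ e) ≡ (ℤ.+ m) ℤ.^ e
  pos-^ m zero    = refl
  pos-^ m (suc e) = trans (pos-* m (m ^ e)) (cong (ℤ.+ m ℤ.*_) (pos-^ m e))

  pos-4[L+1]²+4 : ∀ L → ℤ.+ (4 * (L + 1) ^ 2 + 4) ≡ ℤ.+ 4 ℤ.* (ℤ.+ L ℤ.+ ℤ.+ 1) ℤ.^ 2 ℤ.+ ℤ.+ 4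
  pos-4[L+1]²+4 L = trans (pos-+ (4 * (L + 1) ^ 2) 4)
                         (cong (ℤ._+ ℤ.+ 4) (trans (pos-* 4 ((L + 1) ^ 2)) (cong (ℤ.+ 4 ℤ.*_) (pos-^ (L + 1) 2))))

  3+L[2L]<4[L+1]²+4 : ∀ L → 3 + L * (2 * L) < 4 * (L + 1) ^ 2 + 4
  3+L[2L]<4[L+1]²+4 L = subst (3 + L * (2 * L) <_) (sym (expand L)) (m≤m+n (4 + L * (2 * L)) _)
    where
    open +-*-Solver
    expand : ∀ L → 4 * (L + 1) ^ 2 + 4 ≡ (4 + L * (2 * L)) + (2 * (L * L) + 8 * L + 4)
    expand = solve 1 (λ L → con 4 :* ((L :+ con 1) :* ((L :+ con 1) :* con 1)) :+ con 4
                          := (con 4 :+ L :* (con 2 :* L)) :+ (con 2 :* (L :* L) :+ con 8 :* L :+ con 4)) refl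

  4[L+1]²+4<N⇒3+L[2L]<N : ∀ L N → ℤ.+ 4 ℤ.* (ℤ.+ L ℤ.+ ℤ.+ 1) ℤ.^ 2 ℤ.+ ℤ.+ 4 ℤ.< ℤ.+ N → 3 + L * (2 * L) < N
  4[L+1]²+4<N⇒3+L[2L]<N L N long = <-trans (3+L[2L]<4[L+1]²+4 L) (drop‿+<+ (subst (ℤ._< ℤ.+ N) (sym (pos-4[L+1]²+4 L)) long))

open import Data.Integer using (ℤ; +_; _+_; _*_; _^_; _≤_; _<_; +≤+)
open import Data.Nat.Properties using (<⇒≱; ≤-trans; +-monoʳ-≤; *-mono-≤; *-monoʳ-≤)

lemma15 : ∀ {n : ℕ} (G : Graph n) (s t : Fin n) (A B : Subset n) (ℓ : ℤ)
    (k : ℕ) (P : Fin k → List (Fin n)) →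
    s ≢ t → ¬ Adj G s t →
    IsMinSep G s t A → IsMinSep G s t B → ∣ A ∣ ≡ k →
    IsCanonical G s t k P →
    IsReduced G s t A B k P →
    (∃ λ (i : Fin k) →
    + 4 * (ℓ + + 1) ^ 2 + + 4 < + length (pathVertices G s t (P i))) →
    ∀ (m : ℕ) → TJSeq G s t A B m → ¬ (+ m ≤ ℓ)
lemma15 G s t A B .(+ L) k P _ _ A-min B-min A-size canonical reduced (i , long) m seq (+≤+ {n = L} m≤L) =
  <⇒≱ (4[L+1]²+4<N⇒3+L[2L]<N L _ long)
      (≤-trans (reduced-path-length-bound G s t A B k P A-min B-min A-size canonical reduced i m seq)
               (+-monoʳ-≤ 3 (*-mono-≤ m≤L (*-monoʳ-≤ 2 m≤L))))
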